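{- Let $p$ be a prime and $r\in\mathbb{Z}$. Let $s\in\{0,1,\dots,p-1\}$ be the residue of $-r$ modulo $p$ and $K=\sum_{k=1}^{s}p^k$. Then for all integers $n\geq K$, \[ B_{n,r}\equiv B_{n-K}\pmod p. \]
   Context: $B_n$ denotes the $n$-th Bell number. For every integer $r\in\mathbb{Z}$, the $r$-Bell numbers $B_{n,r}$ are defined by $\sum_{n\geq 0}B_{n,r}\frac{t^n}{n!}=e^{e^t-1+rt}$, so $B_{n,0}=B_n$. -}

module Defs where

open import Data.Nat as ℕ using (ℕ; zero; suc)
open import Data.Nat.Combinatorics using (_C_)
open import Data.Integer as ℤ using (ℤ; +_)

sumℕ : ℕ → (ℕ → ℕ) → ℕ
sumℕ zero    f = 0
sumℕ (suc n) f = sumℕ n f ℕ.+ f n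

sumℤ : ℕ → (ℕ → ℤ) → ℤ
sumℤ zero    f = + 0
sumℤ (suc n) f = sumℤ n f ℤ.+ f n

stirling2 : ℕ → ℕ → ℕ
stirling2 zero    zero    = 1
stirling2 zero    (suc k) = 0
stirling2 (suc n) zero    = 0
stirling2 (suc n) (suc k) = suc k ℕ.* stirling2 n (suc k) ℕ.+ stirling2 n k

bell : ℕ → ℕ
bell n = sumℕ (suc n) (stirling2 n)

-- r-Bell numbers: coefficient of t^n/n! in e^{e^t-1} · e^{rt}, i.e. the
-- binomial convolution  B_{n,r} = Σ_{k=0}^{n} C(n,k) B_k r^{n-k}.
rBell : ℕ → ℤ → ℤ
rBell n r = sumℤ (suc n) (λ k → (+ (n C k)) ℤ.* (+ bell k) ℤ.* (r ℤ.^ (n ℕ.∸ k)))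

geomK : ℕ → ℕ → ℕ
geomK p s = sumℕ s (λ j → p ℕ.^ suc j)

-- Let E be the shift of integer sequences and B the Bell sequence, so that
-- B_{n,r} = ((E + r)ⁿ B)(0). Since p divides C(p,k) for 0 < k < p, and rᵖ ≡ r,
-- modulo p we have (E + r)ᵖ ≡ Eᵖ + r. Touchard's congruence B_{m+p} ≡ B_{m+1} + B_m,
-- i.e. Eᵖ ≡ E + 1 on B, follows from S(p,k) ≡ S(1,k) for k < p, which comes from
-- xᵖ ≡ x by comparing falling-factorial expansions. It passes to every (E + r)-transform
-- of B, and iterating gives E^(pᵏ) ≡ E + k there. For r = -j this reads
-- B_{m+pʲ,-j} ≡ B_{m,1-j}, so removing pˢ, pˢ⁻¹, …, p from n turns B_{n,-s} into B_{n-K};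
-- finally B_{n,r} only depends on r modulo p.
module Submission where

open import Defs
open import Data.Nat using (ℕ; _≤_; _∸_; NonZero)
open import Data.Nat.Primality using (Prime)
open import Data.Integer using (ℤ; +_; -_; _-_; _%ℕ_)
open import Data.Integer.Divisibility using (_∣_)

open import Data.Empty using (⊥-elim)
open import Data.Integer using (0ℤ; 1ℤ; _+_; _*_; _^_; ∣_∣; _/ℕ_)
open import Data.Integer.DivMod using (a≡a%ℕn+[a/ℕn]*n)
import Data.Integer.Divisibility.Signed as Signed
import Data.Integer.Properties as ℤₚ
open import Data.Integer.Tactic.RingSolver using (solve-∀)
open import Data.Nat as ℕ using (zero; suc; _<_; z≤n; s≤s; _!)
open import Data.Nat.Combinatorics
  using (_C_; nCn≡1; nCk+nC[k+1]≡[n+1]C[k+1]; k>n⇒nCk≡0; nCk≡n!/k![n-k]!; k![n∸k]!∣n!)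
open import Data.Nat.Combinatorics.Base using (_P′_)
open import Data.Nat.Combinatorics.Specification using (nP′n≡n!)
open import Data.Nat.Divisibility using (m∣m*n; ∣⇒≤) renaming (_∣_ to _∣ℕ_)
open import Data.Nat.DivMod using (m/n*n≡m)
open import Data.Nat.Induction using (<-rec)
open import Data.Nat.Primality using (euclidsLemma; prime⇒nonTrivial; ¬prime[0])
import Data.Nat.Properties as ℕₚ
open import Data.Sum using (inj₁; inj₂)
open import Level using (0ℓ)
open import Relation.Binary.Bundles using (Setoid)
open import Relation.Binary.PropositionalEquality
import Relation.Binary.Reasoning.Setoid as SetoidReasoning
open import Relation.Nullary using (¬_)

open import Algebra.Properties.CommutativeSemigroup ℤₚ.+-commutativeSemigroup using (interchange)

sumℤ-cong : ∀ n {f g : ℕ → ℤ} → (∀ k → k < n → f k ≡ g k) → sumℤ n f ≡ sumℤ n g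
sumℤ-cong zero    f≡g = refl
sumℤ-cong (suc n) f≡g =
  cong₂ _+_ (sumℤ-cong n (λ k k<n → f≡g k (ℕₚ.m<n⇒m<1+n k<n))) (f≡g n ℕₚ.≤-refl)

sumℤ-+ : ∀ n (f g : ℕ → ℤ) → sumℤ n (λ k → f k + g k) ≡ sumℤ n f + sumℤ n g
sumℤ-+ zero    f g = refl
sumℤ-+ (suc n) f g =
  trans (cong (_+ (f n + g n)) (sumℤ-+ n f g)) (interchange (sumℤ n f) (sumℤ n g) (f n) (g n))

sumℤ-scale : ∀ n c (f : ℕ → ℤ) → sumℤ n (λ k → c * f k) ≡ c * sumℤ n f
sumℤ-scale zero    c f = sym (ℤₚ.*-zeroʳ c)
sumℤ-scale (suc n) c f =
  trans (cong (_+ c * f n) (sumℤ-scale n c f)) (sym (ℤₚ.*-distribˡ-+ c (sumℤ n f) (f n)))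

sumℤ-head : ∀ n (f : ℕ → ℤ) → sumℤ (suc n) f ≡ f 0 + sumℤ n (λ k → f (suc k))
sumℤ-head zero    f = ℤₚ.+-comm 0ℤ (f 0)
sumℤ-head (suc n) f = trans (cong (_+ f (suc n)) (sumℤ-head n f)) (ℤₚ.+-assoc (f 0) _ _)

sumℤ-truncate : ∀ {m N} {f : ℕ → ℤ} → m ≤ N → (∀ k → m ≤ k → f k ≡ 0ℤ) →
                sumℤ N f ≡ sumℤ m f
sumℤ-truncate {N = zero}  z≤n   _   = refl
sumℤ-truncate {m} {suc N} m≤1+N f≡0 with ℕₚ.m≤n⇒m<n∨m≡n m≤1+N
... | inj₁ (s≤s m≤N) = trans (cong₂ _+_ (sumℤ-truncate m≤N f≡0) (f≡0 N m≤N)) (ℤₚ.+-identityʳ _)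
... | inj₂ refl      = refl

sumℤ-shift : ∀ n (f : ℕ → ℤ) → f 0 ≡ 0ℤ → f (suc n) ≡ 0ℤ →
             sumℤ (suc n) f ≡ sumℤ (suc n) (λ k → f (suc k))
sumℤ-shift n f f[0]≡0 f[1+n]≡0 = begin
  sumℤ (suc n) f                  ≡⟨ sumℤ-head n f ⟩
  f 0 + S                         ≡⟨ cong (_+ S) f[0]≡0 ⟩
  0ℤ + S                          ≡⟨ ℤₚ.+-identityˡ S ⟩
  S                               ≡⟨ ℤₚ.+-identityʳ S ⟨
  S + 0ℤ                          ≡⟨ cong (_+_ S) f[1+n]≡0 ⟨
  sumℤ (suc n) (λ k → f (suc k))  ∎
  where
    open ≡-Reasoning
    S = sumℤ n (λ k → f (suc k))

pos-sumℕ : ∀ n (f : ℕ → ℕ) → + sumℕ n f ≡ sumℤ n (λ k → + f k)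
pos-sumℕ zero    f = refl
pos-sumℕ (suc n) f = trans (ℤₚ.pos-+ (sumℕ n f) (f n)) (cong (_+ + f n) (pos-sumℕ n f))

-- Binomial convolution

-- conv r a n = ((E + r)ⁿ a)(0), where E is the shift of sequences.
conv : ℤ → (ℕ → ℤ) → ℕ → ℤ
conv r a zero    = a 0
conv r a (suc n) = r * conv r a n + conv r (λ k → a (suc k)) n

shift+ : ℤ → (ℕ → ℤ) → ℕ → ℤ
shift+ c b m = b (suc m) + c * b m

conv-congʳ : ∀ r n {a b : ℕ → ℤ} → (∀ i → i ≤ n → a i ≡ b i) → conv r a n ≡ conv r b n
conv-congʳ r zero    a≡b = a≡b 0 z≤n
conv-congʳ r (suc n) a≡b =
  cong₂ (λ x y → r * x + y) (conv-congʳ r n (λ i i≤n → a≡b i (ℕₚ.m≤n⇒m≤1+n i≤n)))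
                            (conv-congʳ r n (λ i i≤n → a≡b (suc i) (s≤s i≤n)))

conv-+ : ∀ r n (a b : ℕ → ℤ) → conv r (λ i → a i + b i) n ≡ conv r a n + conv r b n
conv-+ r zero    a b = refl
conv-+ r (suc n) a b = begin
  r * conv r (λ i → a i + b i) n + conv r (λ i → a′ i + b′ i) n
    ≡⟨ cong₂ (λ x y → r * x + y) (conv-+ r n a b) (conv-+ r n a′ b′) ⟩
  r * (conv r a n + conv r b n) + (conv r a′ n + conv r b′ n)
    ≡⟨ cong (_+ (conv r a′ n + conv r b′ n)) (ℤₚ.*-distribˡ-+ r (conv r a n) (conv r b n)) ⟩
  r * conv r a n + r * conv r b n + (conv r a′ n + conv r b′ n)
    ≡⟨ interchange (r * conv r a n) (r * conv r b n) (conv r a′ n) (conv r b′ n) ⟩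
  conv r a (suc n) + conv r b (suc n) ∎
  where
    open ≡-Reasoning
    a′ b′ : ℕ → ℤ
    a′ i = a (suc i)
    b′ i = b (suc i)

conv-scale : ∀ r n c (a : ℕ → ℤ) → conv r (λ i → c * a i) n ≡ c * conv r a n
conv-scale r zero    c a = refl
conv-scale r (suc n) c a =
  trans (cong₂ (λ x y → r * x + y) (conv-scale r n c a) (conv-scale r n c (λ i → a (suc i))))
        (lemma r c (conv r a n) (conv r (λ i → a (suc i)) n))
  where lemma : ∀ r c x y → r * (c * x) + c * y ≡ c * (r * x + y)
        lemma = solve-∀

conv-zero : ∀ r n → conv r (λ _ → 0ℤ) n ≡ 0ℤ
conv-zero r zero    = refl
conv-zero r (suc n) = trans (cong (λ x → r * x + x) (conv-zero r n)) (cong (_+ 0ℤ) (ℤₚ.*-zeroʳ r))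

conv-sumℤ : ∀ r n N (f : ℕ → ℕ → ℤ) →
            conv r (λ i → sumℤ N (λ k → f k i)) n ≡ sumℤ N (λ k → conv r (f k) n)
conv-sumℤ r n zero    f = conv-zero r n
conv-sumℤ r n (suc N) f =
  trans (conv-+ r n (λ i → sumℤ N (λ k → f k i)) (f N)) (cong (_+ conv r (f N) n) (conv-sumℤ r n N f))

conv-0ℤ : ∀ n (a : ℕ → ℤ) → conv 0ℤ a n ≡ a n
conv-0ℤ zero    a = refl
conv-0ℤ (suc n) a = trans (ℤₚ.+-identityˡ _) (conv-0ℤ n (λ k → a (suc k)))

conv-suc : ∀ r n (a : ℕ → ℤ) → conv r a (suc n) ≡ conv r (shift+ r a) n
conv-suc r n a = sym (begin
  conv r (λ i → a (suc i) + r * a i) n       ≡⟨ conv-+ r n (λ i → a (suc i)) (λ i → r * a i) ⟩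
  A′ + conv r (λ i → r * a i) n              ≡⟨ cong (_+_ A′) (conv-scale r n r a) ⟩
  A′ + r * conv r a n                        ≡⟨ ℤₚ.+-comm A′ (r * conv r a n) ⟩
  conv r a (suc n)                           ∎)
  where
    open ≡-Reasoning
    A′ = conv r (λ i → a (suc i)) n

shift+-conv : ∀ r n (a : ℕ → ℤ) → shift+ (- r) (conv r a) n ≡ conv r (λ k → a (suc k)) n
shift+-conv r n a = lemma r (conv r a n) (conv r (λ k → a (suc k)) n)
  where lemma : ∀ r x y → r * x + y + - r * x ≡ y
        lemma = solve-∀

conv-compose : ∀ r s n (a : ℕ → ℤ) → conv (r + s) a n ≡ conv r (conv s a) n
conv-compose r s zero    a = refl
conv-compose r s (suc n) a = begin
  (r + s) * conv (r + s) a n + conv (r + s) (λ k → a (suc k)) n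
    ≡⟨ cong₂ (λ x y → (r + s) * x + y) (conv-compose r s n a) (conv-compose r s n (λ k → a (suc k))) ⟩
  (r + s) * X + Y
    ≡⟨ lemma r s X Y ⟩
  r * X + (s * X + Y)
    ≡⟨ cong (λ x → r * X + (x + Y)) (conv-scale r n s (conv s a)) ⟨
  r * X + (conv r (λ i → s * conv s a i) n + Y)
    ≡⟨ cong (_+_ (r * X)) (conv-+ r n (λ i → s * conv s a i) (conv s (λ k → a (suc k)))) ⟨
  conv r (conv s a) (suc n) ∎
  where
    open ≡-Reasoning
    X = conv r (conv s a) n
    Y = conv r (conv s (λ k → a (suc k))) n
    lemma : ∀ r s x y → (r + s) * x + y ≡ r * x + (s * x + y)
    lemma = solve-∀

conv-split : ∀ r j n (a : ℕ → ℤ) →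
             conv r a (j ℕ.+ n) ≡ conv r (λ k → conv r (λ i → a (i ℕ.+ k)) j) n
conv-split r zero    n a = refl
conv-split r (suc j) n a = begin
  r * conv r a (j ℕ.+ n) + conv r (λ k → a (suc k)) (j ℕ.+ n)
    ≡⟨ cong₂ (λ x y → r * x + y) (conv-split r j n a) (conv-split r j n (λ k → a (suc k))) ⟩
  r * conv r A n + conv r A′ n
    ≡⟨ cong (_+ conv r A′ n) (conv-scale r n r A) ⟨
  conv r (λ k → r * A k) n + conv r A′ n
    ≡⟨ conv-+ r n (λ k → r * A k) A′ ⟨
  conv r (λ k → r * A k + A′ k) n ∎
  where
    open ≡-Reasoning
    A A′ : ℕ → ℤ
    A  k = conv r (λ i → a (i ℕ.+ k)) j
    A′ k = conv r (λ i → a (suc (i ℕ.+ k))) j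

conv-pow : ∀ c x n → conv c (x ^_) n ≡ (c + x) ^ n
conv-pow c x zero    = refl
conv-pow c x (suc n) = begin
  c * X + conv c (λ i → x * x ^ i) n  ≡⟨ cong (_+_ (c * X)) (conv-scale c n x (x ^_)) ⟩
  c * X + x * X                       ≡⟨ cong (λ y → c * y + x * y) (conv-pow c x n) ⟩
  c * (c + x) ^ n + x * (c + x) ^ n   ≡⟨ ℤₚ.*-distribʳ-+ ((c + x) ^ n) c x ⟨
  (c + x) ^ suc n                     ∎
  where
    open ≡-Reasoning
    X = conv c (x ^_) n

binomialSum : ℤ → (ℕ → ℤ) → ℕ → ℤ
binomialSum r a n = sumℤ (suc n) (λ k → + (n C k) * a k * r ^ (n ∸ k))

binomialSum-suc : ∀ r a n →
                  binomialSum r a (suc n) ≡ r * binomialSum r a n + binomialSum r (λ k → a (suc k)) n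
binomialSum-suc r a n = begin
  sumℤ (suc (suc n)) T
    ≡⟨ sumℤ-head (suc n) T ⟩
  T 0 + sumℤ (suc n) (λ k → T (suc k))
    ≡⟨ cong (_+_ (T 0)) (trans (sumℤ-cong (suc n) (λ k _ → pascal k)) (sumℤ-+ (suc n) t′ u)) ⟩
  T 0 + (sumℤ (suc n) t′ + sumℤ (suc n) u)
    ≡⟨ cong (λ x → T 0 + (sumℤ (suc n) t′ + x)) u-sum ⟩
  T 0 + (sumℤ (suc n) t′ + r * sumℤ n (λ k → t (suc k)))
    ≡⟨ lemma r (a 0) (r ^ n) (sumℤ (suc n) t′) (sumℤ n (λ k → t (suc k))) ⟩
  r * (t 0 + sumℤ n (λ k → t (suc k))) + sumℤ (suc n) t′
    ≡⟨ cong (λ x → r * x + sumℤ (suc n) t′) (sumℤ-head n t) ⟨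
  r * binomialSum r a n + binomialSum r (λ k → a (suc k)) n ∎
  where
    open ≡-Reasoning
    T t t′ u : ℕ → ℤ
    T  k = + (suc n C k) * a k * r ^ (suc n ∸ k)
    t  k = + (n C k) * a k * r ^ (n ∸ k)
    t′ k = + (n C k) * a (suc k) * r ^ (n ∸ k)
    u  k = + (n C suc k) * a (suc k) * r ^ (n ∸ k)

    pascal : ∀ k → T (suc k) ≡ t′ k + u k
    pascal k = begin
      + (suc n C suc k) * a (suc k) * r ^ (n ∸ k)
        ≡⟨ cong (λ c → + c * a (suc k) * r ^ (n ∸ k)) (nCk+nC[k+1]≡[n+1]C[k+1] n k) ⟨
      + (n C k ℕ.+ n C suc k) * a (suc k) * r ^ (n ∸ k)
        ≡⟨ cong (λ c → c * a (suc k) * r ^ (n ∸ k)) (ℤₚ.pos-+ (n C k) (n C suc k)) ⟩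
      (+ (n C k) + + (n C suc k)) * a (suc k) * r ^ (n ∸ k)
        ≡⟨ distrib (+ (n C k)) (+ (n C suc k)) (a (suc k)) (r ^ (n ∸ k)) ⟩
      t′ k + u k ∎
      where distrib : ∀ c d x y → (c + d) * x * y ≡ c * x * y + d * x * y
            distrib = solve-∀

    u-sum : sumℤ (suc n) u ≡ r * sumℤ n (λ k → t (suc k))
    u-sum = begin
      sumℤ n u + u n                  ≡⟨ cong (_+_ (sumℤ n u)) u[n]≡0 ⟩
      sumℤ n u + 0ℤ                   ≡⟨ ℤₚ.+-identityʳ _ ⟩
      sumℤ n u                        ≡⟨ sumℤ-cong n u≡r*t ⟩
      sumℤ n (λ k → r * t (suc k))    ≡⟨ sumℤ-scale n r (λ k → t (suc k)) ⟩
      r * sumℤ n (λ k → t (suc k))    ∎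
      where
        u[n]≡0 : u n ≡ 0ℤ
        u[n]≡0 rewrite k>n⇒nCk≡0 (ℕₚ.n<1+n n) = refl
        u≡r*t : ∀ k → k < n → u k ≡ r * t (suc k)
        u≡r*t k k<n rewrite ℕₚ.+-∸-assoc 1 k<n =
          rotate (+ (n C suc k)) (a (suc k)) r (r ^ (n ∸ suc k))
          where rotate : ∀ c x r y → c * x * (r * y) ≡ r * (c * x * y)
                rotate = solve-∀

    lemma : ∀ r x y s t → + 1 * x * (r * y) + (s + r * t) ≡ r * (+ 1 * x * y + t) + s
    lemma = solve-∀

conv≡binomialSum : ∀ r a n → conv r a n ≡ binomialSum r a n
conv≡binomialSum r a zero    = lemma (a 0)
  where lemma : ∀ x → x ≡ 0ℤ + + 1 * x * 1ℤ
        lemma = solve-∀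
conv≡binomialSum r a (suc n) =
  trans (cong₂ (λ x y → r * x + y) (conv≡binomialSum r a n) (conv≡binomialSum r (λ k → a (suc k)) n))
        (sym (binomialSum-suc r a n))

-- Factorials, Stirling and Bell numbers

nCk*k![n∸k]!≡n! : ∀ {n k} → k ≤ n → (n C k) ℕ.* (k ! ℕ.* (n ∸ k) !) ≡ n !
nCk*k![n∸k]!≡n! {n} {k} k≤n =
  trans (cong (ℕ._* (k ! ℕ.* (n ∸ k) !)) (nCk≡n!/k![n-k]! k≤n))
        (m/n*n≡m {{ℕₚ._!*_!≢0 k (n ∸ k)}} (k![n∸k]!∣n! k≤n))

k>n⇒nP′k≡0 : ∀ {n k} → n < k → n P′ k ≡ 0
k>n⇒nP′k≡0 {n} {suc k} (s≤s n≤k) with ℕₚ.m≤n⇒m<n∨m≡n n≤k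
... | inj₁ n<k  = trans (cong ((n ∸ k) ℕ.*_) (k>n⇒nP′k≡0 n<k)) (ℕₚ.*-zeroʳ (n ∸ k))
... | inj₂ refl = cong (ℕ._* (n P′ n)) (ℕₚ.n∸n≡0 n)

n*nP′k≡nP′[1+k]+k*nP′k : ∀ n k → n ℕ.* (n P′ k) ≡ n P′ suc k ℕ.+ k ℕ.* (n P′ k)
n*nP′k≡nP′[1+k]+k*nP′k n k with ℕₚ.≤-<-connex k n
... | inj₁ k≤n =
  trans (cong (ℕ._* (n P′ k)) (sym (ℕₚ.m∸n+n≡m k≤n))) (ℕₚ.*-distribʳ-+ (n P′ k) (n ∸ k) k)
... | inj₂ n<k rewrite k>n⇒nP′k≡0 n<k | ℕₚ.*-zeroʳ n | ℕₚ.*-zeroʳ (n ∸ k) | ℕₚ.*-zeroʳ k = refl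

k>n⇒stirling2[n,k]≡0 : ∀ {n k} → n < k → stirling2 n k ≡ 0
k>n⇒stirling2[n,k]≡0 {zero}  {suc k} _ = refl
k>n⇒stirling2[n,k]≡0 {suc n} {suc k} (s≤s n<k)
  rewrite k>n⇒stirling2[n,k]≡0 (ℕₚ.m<n⇒m<1+n n<k) | k>n⇒stirling2[n,k]≡0 n<k =
  trans (ℕₚ.+-identityʳ _) (ℕₚ.*-zeroʳ (suc k))

stirling2[n,n]≡1 : ∀ n → stirling2 n n ≡ 1
stirling2[n,n]≡1 zero    = refl
stirling2[n,n]≡1 (suc n) rewrite k>n⇒stirling2[n,k]≡0 (ℕₚ.n<1+n n) | stirling2[n,n]≡1 n =
  cong (ℕ._+ 1) (ℕₚ.*-zeroʳ n)

stirling2ℤ : ℕ → ℕ → ℤ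
stirling2ℤ n k = + stirling2 n k

bellℤ : ℕ → ℤ
bellℤ n = + bell n

stirling2ℤ-suc : ∀ n k →
                 stirling2ℤ (suc n) (suc k) ≡ + suc k * stirling2ℤ n (suc k) + stirling2ℤ n k
stirling2ℤ-suc n k = trans (ℤₚ.pos-+ (suc k ℕ.* stirling2 n (suc k)) (stirling2 n k))
                           (cong (_+ stirling2ℤ n k) (ℤₚ.pos-* (suc k) (stirling2 n (suc k))))

falling-factorial-expansion : ∀ j n → (+ j) ^ n ≡ sumℤ (suc n) (λ k → stirling2ℤ n k * + (j P′ k))
falling-factorial-expansion j zero    = refl
falling-factorial-expansion j (suc n) = begin
  + j * (+ j) ^ n
    ≡⟨ cong (+ j *_) (falling-factorial-expansion j n) ⟩
  + j * sumℤ (suc n) (λ k → stirling2ℤ n k * F k)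
    ≡⟨ sumℤ-scale (suc n) (+ j) (λ k → stirling2ℤ n k * F k) ⟨
  sumℤ (suc n) (λ k → + j * (stirling2ℤ n k * F k))
    ≡⟨ sumℤ-cong (suc n) (λ k _ → lower k) ⟩
  sumℤ (suc n) (λ k → stirling2ℤ n k * F (suc k) + g k)
    ≡⟨ sumℤ-+ (suc n) (λ k → stirling2ℤ n k * F (suc k)) g ⟩
  sumℤ (suc n) (λ k → stirling2ℤ n k * F (suc k)) + sumℤ (suc n) g
    ≡⟨ cong (_+_ (sumℤ (suc n) (λ k → stirling2ℤ n k * F (suc k)))) (sumℤ-shift n g refl g[1+n]≡0) ⟩
  sumℤ (suc n) (λ k → stirling2ℤ n k * F (suc k)) + sumℤ (suc n) (λ k → g (suc k))
    ≡⟨ sumℤ-+ (suc n) (λ k → stirling2ℤ n k * F (suc k)) (λ k → g (suc k)) ⟨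
  sumℤ (suc n) (λ k → stirling2ℤ n k * F (suc k) + g (suc k))
    ≡⟨ sumℤ-cong (suc n) (λ k _ → raise k) ⟩
  sumℤ (suc n) (λ k → stirling2ℤ (suc n) (suc k) * F (suc k))
    ≡⟨ trans (sumℤ-head (suc n) _) (ℤₚ.+-identityˡ _) ⟨
  sumℤ (suc (suc n)) (λ k → stirling2ℤ (suc n) k * F k) ∎
  where
    open ≡-Reasoning
    F g : ℕ → ℤ
    F k = + (j P′ k)
    g k = + k * stirling2ℤ n k * F k

    g[1+n]≡0 : g (suc n) ≡ 0ℤ
    g[1+n]≡0 rewrite k>n⇒stirling2[n,k]≡0 (ℕₚ.n<1+n n) | ℤₚ.*-zeroʳ (+ suc n) = refl

    lower : ∀ k → + j * (stirling2ℤ n k * F k) ≡ stirling2ℤ n k * F (suc k) + g k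
    lower k = begin
      + j * (stirling2ℤ n k * F k)
        ≡⟨ swap (+ j) (stirling2ℤ n k) (F k) ⟩
      stirling2ℤ n k * (+ j * F k)
        ≡⟨ cong (stirling2ℤ n k *_) (ℤₚ.pos-* j (j P′ k)) ⟨
      stirling2ℤ n k * + (j ℕ.* (j P′ k))
        ≡⟨ cong (λ x → stirling2ℤ n k * + x) (n*nP′k≡nP′[1+k]+k*nP′k j k) ⟩
      stirling2ℤ n k * + (j P′ suc k ℕ.+ k ℕ.* (j P′ k))
        ≡⟨ cong (stirling2ℤ n k *_) (trans (ℤₚ.pos-+ (j P′ suc k) (k ℕ.* (j P′ k)))
                                           (cong (_+_ (F (suc k))) (ℤₚ.pos-* k (j P′ k)))) ⟩
      stirling2ℤ n k * (F (suc k) + + k * F k)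
        ≡⟨ spread (stirling2ℤ n k) (F (suc k)) (+ k) (F k) ⟩
      stirling2ℤ n k * F (suc k) + g k ∎
      where
        swap : ∀ a b c → a * (b * c) ≡ b * (a * c)
        swap = solve-∀
        spread : ∀ a b c d → a * (b + c * d) ≡ a * b + c * a * d
        spread = solve-∀

    raise : ∀ k → stirling2ℤ n k * F (suc k) + g (suc k) ≡ stirling2ℤ (suc n) (suc k) * F (suc k)
    raise k = sym (trans (cong (_* F (suc k)) (stirling2ℤ-suc n k))
                         (spread (+ suc k) (stirling2ℤ n (suc k)) (stirling2ℤ n k) (F (suc k))))
      where spread : ∀ a b c d → (a * b + c) * d ≡ c * d + a * b * d
            spread = solve-∀

stirling2-column : ∀ n k → stirling2ℤ (suc n) (suc k) ≡ conv 1ℤ (λ i → stirling2ℤ i k) n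
stirling2-column zero    zero    = refl
stirling2-column zero    (suc k) = cong +_ (trans (ℕₚ.+-identityʳ _) (ℕₚ.*-zeroʳ (suc (suc k))))
stirling2-column (suc n) zero    = begin
  stirling2ℤ (suc (suc n)) 1     ≡⟨ stirling2ℤ-suc (suc n) 0 ⟩
  + 1 * stirling2ℤ (suc n) 1 + 0ℤ ≡⟨ cong (λ x → + 1 * x + 0ℤ) (stirling2-column n 0) ⟩
  1ℤ * C[0] + 0ℤ                 ≡⟨ cong (_+_ (1ℤ * C[0])) (conv-zero 1ℤ n) ⟨
  conv 1ℤ (λ i → stirling2ℤ i 0) (suc n) ∎
  where
    open ≡-Reasoning
    C[0] = conv 1ℤ (λ i → stirling2ℤ i 0) n
stirling2-column (suc n) (suc k) = begin
  stirling2ℤ (suc (suc n)) (suc (suc k))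
    ≡⟨ stirling2ℤ-suc (suc n) (suc k) ⟩
  + suc (suc k) * stirling2ℤ (suc n) (suc (suc k)) + stirling2ℤ (suc n) (suc k)
    ≡⟨ cong₂ (λ x y → + suc (suc k) * x + y) (stirling2-column n (suc k)) (stirling2-column n k) ⟩
  + suc (suc k) * C[k+1] + C[k]
    ≡⟨ lemma (+ suc k) C[k+1] C[k] ⟩
  1ℤ * C[k+1] + (+ suc k * C[k+1] + C[k])
    ≡⟨ cong (λ x → 1ℤ * C[k+1] + (x + C[k])) (conv-scale 1ℤ n (+ suc k) (λ i → stirling2ℤ i (suc k))) ⟨
  1ℤ * C[k+1] + (conv 1ℤ (λ i → + suc k * stirling2ℤ i (suc k)) n + C[k])
    ≡⟨ cong (_+_ (1ℤ * C[k+1])) (conv-+ 1ℤ n (λ i → + suc k * stirling2ℤ i (suc k))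
                                             (λ i → stirling2ℤ i k)) ⟨
  1ℤ * C[k+1] + conv 1ℤ (λ i → + suc k * stirling2ℤ i (suc k) + stirling2ℤ i k) n
    ≡⟨ cong (_+_ (1ℤ * C[k+1])) (conv-congʳ 1ℤ n (λ i _ → stirling2ℤ-suc i k)) ⟨
  conv 1ℤ (λ i → stirling2ℤ i (suc k)) (suc n) ∎
  where
    open ≡-Reasoning
    C[k+1] = conv 1ℤ (λ i → stirling2ℤ i (suc k)) n
    C[k]   = conv 1ℤ (λ i → stirling2ℤ i k) n
    lemma : ∀ a x y → (1ℤ + a) * x + y ≡ 1ℤ * x + (a * x + y)
    lemma = solve-∀

bellℤ≡Σstirling2 : ∀ {n N} → n < N → bellℤ n ≡ sumℤ N (stirling2ℤ n)
bellℤ≡Σstirling2 {n} n<N =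
  trans (pos-sumℕ (suc n) (stirling2 n))
        (sym (sumℤ-truncate n<N (λ k n<k → cong +_ (k>n⇒stirling2[n,k]≡0 n<k))))

bellℤ-suc : ∀ n → bellℤ (suc n) ≡ conv 1ℤ bellℤ n
bellℤ-suc n = begin
  bellℤ (suc n)
    ≡⟨ bellℤ≡Σstirling2 (ℕₚ.n<1+n (suc n)) ⟩
  sumℤ (suc (suc n)) (stirling2ℤ (suc n))
    ≡⟨ trans (sumℤ-head (suc n) _) (ℤₚ.+-identityˡ _) ⟩
  sumℤ (suc n) (λ k → stirling2ℤ (suc n) (suc k))
    ≡⟨ sumℤ-cong (suc n) (λ k _ → stirling2-column n k) ⟩
  sumℤ (suc n) (λ k → conv 1ℤ (λ i → stirling2ℤ i k) n)
    ≡⟨ conv-sumℤ 1ℤ n (suc n) (λ k i → stirling2ℤ i k) ⟨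
  conv 1ℤ (λ i → sumℤ (suc n) (stirling2ℤ i)) n
    ≡⟨ conv-congʳ 1ℤ n (λ i i≤n → bellℤ≡Σstirling2 (s≤s i≤n)) ⟨
  conv 1ℤ bellℤ n ∎
  where open ≡-Reasoning

bellℤ-suc-suc : ∀ n → bellℤ (suc (suc n)) ≡ conv 1ℤ (λ i → bellℤ (suc i) + bellℤ i) n
bellℤ-suc-suc n = begin
  bellℤ (suc (suc n))                     ≡⟨ bellℤ-suc (suc n) ⟩
  1ℤ * conv 1ℤ bellℤ n + B′               ≡⟨ cong (_+ B′) (ℤₚ.*-identityˡ (conv 1ℤ bellℤ n)) ⟩
  conv 1ℤ bellℤ n + B′                    ≡⟨ ℤₚ.+-comm (conv 1ℤ bellℤ n) B′ ⟩
  B′ + conv 1ℤ bellℤ n                    ≡⟨ conv-+ 1ℤ n (λ i → bellℤ (suc i)) bellℤ ⟨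
  conv 1ℤ (λ i → bellℤ (suc i) + bellℤ i) n ∎
  where
    open ≡-Reasoning
    B′ = conv 1ℤ (λ i → bellℤ (suc i)) n

conv-bell-shift : ∀ r n → conv r (λ k → bellℤ (suc k)) n ≡ conv (r + 1ℤ) bellℤ n
conv-bell-shift r n = trans (conv-congʳ r n (λ i _ → bellℤ-suc i)) (sym (conv-compose r 1ℤ n bellℤ))

-- Congruences

-- A record rather than a synonym for m ∣ a - b, so that a and b can be inferred.
infix 4 _≡_mod_
record _≡_mod_ (a b m : ℤ) : Set where
  constructor congruent
  field difference : m Signed.∣ a - b

module _ {m : ℤ} where

  mod-reflexive : ∀ {a b} → a ≡ b → a ≡ b mod m
  mod-reflexive {a} refl = congruent (Signed.divides 0ℤ (ℤₚ.+-inverseʳ a))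

  mod-refl : ∀ {a} → a ≡ a mod m
  mod-refl = mod-reflexive refl

  mod-sym : ∀ {a b} → a ≡ b mod m → b ≡ a mod m
  mod-sym {a} {b} (congruent m∣a-b) =
    congruent (subst (m Signed.∣_) (lemma a b) (Signed.∣m⇒∣-m m∣a-b))
    where lemma : ∀ a b → - (a - b) ≡ b - a
          lemma = solve-∀

  mod-trans : ∀ {a b c} → a ≡ b mod m → b ≡ c mod m → a ≡ c mod m
  mod-trans {a} {b} {c} (congruent m∣a-b) (congruent m∣b-c) =
    congruent (subst (m Signed.∣_) (lemma a b c) (Signed.∣m∣n⇒∣m+n m∣a-b m∣b-c))
    where lemma : ∀ a b c → a - b + (b - c) ≡ a - c
          lemma = solve-∀

  +-cong-mod : ∀ {a b c d} → a ≡ b mod m → c ≡ d mod m → a + c ≡ b + d mod m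
  +-cong-mod {a} {b} {c} {d} (congruent m∣a-b) (congruent m∣c-d) =
    congruent (subst (m Signed.∣_) (lemma a b c d) (Signed.∣m∣n⇒∣m+n m∣a-b m∣c-d))
    where lemma : ∀ a b c d → a - b + (c - d) ≡ a + c - (b + d)
          lemma = solve-∀

  *-cong-mod : ∀ {a b c d} → a ≡ b mod m → c ≡ d mod m → a * c ≡ b * d mod m
  *-cong-mod {a} {b} {c} {d} (congruent m∣a-b) (congruent m∣c-d) =
    congruent (subst (m Signed.∣_) (lemma a b c d)
                     (Signed.∣m∣n⇒∣m+n (Signed.∣m⇒∣m*n c m∣a-b) (Signed.∣n⇒∣m*n b m∣c-d)))
    where lemma : ∀ a b c d → (a - b) * c + b * (c - d) ≡ a * c - b * d
          lemma = solve-∀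

  neg-cong-mod : ∀ {a b} → a ≡ b mod m → - a ≡ - b mod m
  neg-cong-mod {a} {b} (congruent m∣a-b) =
    congruent (subst (m Signed.∣_) (lemma a b) (Signed.∣m⇒∣-m m∣a-b))
    where lemma : ∀ a b → - (a - b) ≡ - a - - b
          lemma = solve-∀

  ^-cong-mod : ∀ {a b} k → a ≡ b mod m → a ^ k ≡ b ^ k mod m
  ^-cong-mod zero    _   = mod-refl
  ^-cong-mod (suc k) a≡b = *-cong-mod a≡b (^-cong-mod k a≡b)

  +-cancelˡ-mod : ∀ {a b c d} → a ≡ b mod m → a + c ≡ b + d mod m → c ≡ d mod m
  +-cancelˡ-mod {a} {b} {c} {d} a≡b a+c≡b+d =
    subst₂ (λ x y → x ≡ y mod m) (lemma a c) (lemma b d) (+-cong-mod a+c≡b+d (neg-cong-mod a≡b))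
    where lemma : ∀ a c → a + c + - a ≡ c
          lemma = solve-∀

  ∣⇒≡0-mod : ∀ {a} → m Signed.∣ a → a ≡ 0ℤ mod m
  ∣⇒≡0-mod {a} m∣a = congruent (subst (m Signed.∣_) (sym (ℤₚ.+-identityʳ a)) m∣a)

  sumℤ-cong-mod : ∀ n {f g : ℕ → ℤ} → (∀ k → k < n → f k ≡ g k mod m) →
                  sumℤ n f ≡ sumℤ n g mod m
  sumℤ-cong-mod zero    f≡g = mod-refl
  sumℤ-cong-mod (suc n) f≡g =
    +-cong-mod (sumℤ-cong-mod n (λ k k<n → f≡g k (ℕₚ.m<n⇒m<1+n k<n))) (f≡g n ℕₚ.≤-refl)

  sumℤ-≡0-mod : ∀ n {f : ℕ → ℤ} → (∀ k → k < n → f k ≡ 0ℤ mod m) → sumℤ n f ≡ 0ℤ mod m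
  sumℤ-≡0-mod zero    f≡0 = mod-refl
  sumℤ-≡0-mod (suc n) f≡0 =
    +-cong-mod (sumℤ-≡0-mod n (λ k k<n → f≡0 k (ℕₚ.m<n⇒m<1+n k<n))) (f≡0 n ℕₚ.≤-refl)

  conv-congʳ-mod : ∀ r n {a b : ℕ → ℤ} → (∀ i → i ≤ n → a i ≡ b i mod m) →
                   conv r a n ≡ conv r b n mod m
  conv-congʳ-mod r zero    a≡b = a≡b 0 z≤n
  conv-congʳ-mod r (suc n) a≡b =
    +-cong-mod (*-cong-mod (mod-refl {r}) (conv-congʳ-mod r n (λ i i≤n → a≡b i (ℕₚ.m≤n⇒m≤1+n i≤n))))
               (conv-congʳ-mod r n (λ i i≤n → a≡b (suc i) (s≤s i≤n)))

  conv-congˡ-mod : ∀ {r s} n (a : ℕ → ℤ) → r ≡ s mod m → conv r a n ≡ conv s a n mod m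
  conv-congˡ-mod zero    a r≡s = mod-refl
  conv-congˡ-mod (suc n) a r≡s =
    +-cong-mod (*-cong-mod r≡s (conv-congˡ-mod n a r≡s)) (conv-congˡ-mod n (λ k → a (suc k)) r≡s)

  conv-recurrence-unique : ∀ {r} {x y f : ℕ → ℤ} → x 0 ≡ y 0 mod m →
                           (∀ k → x (suc k) ≡ conv r x k + f k mod m) →
                           (∀ k → y (suc k) ≡ conv r y k + f k mod m) →
                           ∀ k → x k ≡ y k mod m
  conv-recurrence-unique {r} {x} {y} x₀≡y₀ x-rec y-rec = <-rec _ step
    where
      step : ∀ k → (∀ {i} → i < k → x i ≡ y i mod m) → x k ≡ y k mod m
      step zero    _  = x₀≡y₀
      step (suc k) ih =
        mod-trans (x-rec k)
                  (mod-trans (+-cong-mod (conv-congʳ-mod r k (λ i i≤k → ih (s≤s i≤k))) mod-refl)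
                             (mod-sym (y-rec k)))

mod-setoid : ℤ → Setoid 0ℓ 0ℓ
mod-setoid m = record
  { Carrier       = ℤ
  ; _≈_           = λ a b → a ≡ b mod m
  ; isEquivalence = record { refl = mod-refl ; sym = mod-sym ; trans = mod-trans }
  }

%ℕ-mod : ∀ x d .{{_ : NonZero d}} → x ≡ + (x %ℕ d) mod + d
%ℕ-mod x d = congruent (Signed.divides (x /ℕ d) (begin
  x - + (x %ℕ d)                            ≡⟨ cong (_- + (x %ℕ d)) (a≡a%ℕn+[a/ℕn]*n x d) ⟩
  + (x %ℕ d) + (x /ℕ d) * + d - + (x %ℕ d)  ≡⟨ lemma (+ (x %ℕ d)) ((x /ℕ d) * + d) ⟩
  (x /ℕ d) * + d                            ∎))
  where
    open ≡-Reasoning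
    lemma : ∀ a b → a + b - a ≡ b
    lemma = solve-∀

-- Modulo a prime

module _ {n : ℕ} (p-prime : Prime (suc n)) where

  private
    p : ℕ
    p = suc n

    P : ℤ
    P = + p

  open SetoidReasoning (mod-setoid P)

  1<p : 1 < p
  1<p = ℕ.nonTrivial⇒n>1 p {{prime⇒nonTrivial p-prime}}

  p∤m! : ∀ {m} → m < p → ¬ p ∣ℕ m !
  p∤m! {zero}  _     p∣1  = ℕₚ.<⇒≱ 1<p (∣⇒≤ p∣1)
  p∤m! {suc m} 1+m<p p∣[1+m]! with euclidsLemma (suc m) (m !) p-prime p∣[1+m]!
  ... | inj₁ p∣1+m = ℕₚ.<⇒≱ 1+m<p (∣⇒≤ p∣1+m)
  ... | inj₂ p∣m!  = p∤m! (ℕₚ.<-trans (ℕₚ.n<1+n m) 1+m<p) p∣m!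

  p∣pC[1+k] : ∀ {k} → k < n → p ∣ℕ p C suc k
  p∣pC[1+k] {k} k<n with euclidsLemma (p C suc k) (suc k ! ℕ.* (n ∸ k) !) p-prime
                          (subst (p ∣ℕ_) (sym (nCk*k![n∸k]!≡n! (s≤s (ℕₚ.<⇒≤ k<n)))) (m∣m*n (n !)))
  ... | inj₁ p∣pC[1+k] = p∣pC[1+k]
  ... | inj₂ p∣[1+k]!*[n-k]! with euclidsLemma (suc k !) ((n ∸ k) !) p-prime p∣[1+k]!*[n-k]!
  ...   | inj₁ p∣[1+k]! = ⊥-elim (p∤m! (s≤s k<n) p∣[1+k]!)
  ...   | inj₂ p∣[n-k]! = ⊥-elim (p∤m! (s≤s (ℕₚ.m∸n≤m n k)) p∣[n-k]!)

  *-cancelʳ-mod : ∀ {x y c} → ¬ p ∣ℕ c → x * + c ≡ y * + c mod P → x ≡ y mod P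
  *-cancelʳ-mod {x} {y} {c} p∤c (congruent P∣xc-yc)
    with euclidsLemma ∣ x - y ∣ c p-prime
           (subst (p ∣ℕ_) (ℤₚ.abs-* (x - y) (+ c))
                  (Signed.∣⇒∣ᵤ (subst (P Signed.∣_) (factor x y (+ c)) P∣xc-yc)))
    where factor : ∀ x y c → x * c - y * c ≡ (x - y) * c
          factor = solve-∀
  ... | inj₁ p∣x-y = congruent (Signed.∣ᵤ⇒∣ p∣x-y)
  ... | inj₂ p∣c   = ⊥-elim (p∤c p∣c)

  conv-freshman : ∀ c a → conv c a p ≡ a p + c ^ p * a 0 mod P
  conv-freshman c a = begin
    conv c a p
      ≡⟨ conv≡binomialSum c a p ⟩
    sumℤ (suc p) t
      ≡⟨ sumℤ-head p t ⟩
    t 0 + (sumℤ n (λ k → t (suc k)) + t p)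
      ≈⟨ +-cong-mod (mod-refl {a = t 0}) (+-cong-mod inner (mod-refl {a = t p})) ⟩
    t 0 + (0ℤ + t p)
      ≡⟨ cong (λ x → t 0 + (0ℤ + x)) t[p]≡a[p] ⟩
    + 1 * a 0 * c ^ p + (0ℤ + a p)
      ≡⟨ lemma (a 0) (c ^ p) (a p) ⟩
    a p + c ^ p * a 0 ∎
    where
      t : ℕ → ℤ
      t k = + (p C k) * a k * c ^ (p ∸ k)

      inner : sumℤ n (λ k → t (suc k)) ≡ 0ℤ mod P
      inner = sumℤ-≡0-mod n (λ k k<n →
        ∣⇒≡0-mod (Signed.∣m⇒∣m*n (c ^ (p ∸ suc k)) (Signed.∣m⇒∣m*n (a (suc k))
          (Signed.∣ᵤ⇒∣ {P} {+ (p C suc k)} (p∣pC[1+k] k<n)))))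

      t[p]≡a[p] : t p ≡ a p
      t[p]≡a[p] rewrite nCn≡1 p | ℕₚ.n∸n≡0 p = trans (ℤₚ.*-identityʳ _) (ℤₚ.*-identityˡ (a p))

      lemma : ∀ x y z → + 1 * x * y + (0ℤ + z) ≡ z + y * x
      lemma = solve-∀

  fermat : ∀ x → x ^ p ≡ x mod P
  fermat x = begin
    x ^ p               ≈⟨ ^-cong-mod p (%ℕ-mod x p) ⟩
    (+ (x %ℕ p)) ^ p    ≈⟨ fermatℕ (x %ℕ p) ⟩
    + (x %ℕ p)          ≈⟨ %ℕ-mod x p ⟨
    x                   ∎
    where
      fermatℕ : ∀ j → (+ j) ^ p ≡ + j mod P
      fermatℕ zero    = mod-refl
      fermatℕ (suc j) = begin
        (+ suc j) ^ p                ≡⟨ conv-pow 1ℤ (+ j) p ⟨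
        conv 1ℤ ((+ j) ^_) p         ≈⟨ conv-freshman 1ℤ ((+ j) ^_) ⟩
        (+ j) ^ p + 1ℤ ^ p * 1ℤ      ≡⟨ cong (λ y → (+ j) ^ p + y * 1ℤ) (ℤₚ.^-zeroˡ p) ⟩
        (+ j) ^ p + 1ℤ               ≈⟨ +-cong-mod (fermatℕ j) (mod-refl {a = 1ℤ}) ⟩
        + j + 1ℤ                     ≡⟨ cong +_ (ℕₚ.+-comm j 1) ⟩
        + suc j                      ∎

  -- The values at 0, …, p - 1 determine the coefficients, since m P′ k vanishes for k > m
  -- and m P′ m = m! is invertible modulo p.
  falling-coefficients-unique : ∀ {N} (a b : ℕ → ℤ) → p ≤ N →
    (∀ m → m < p → sumℤ N (λ k → a k * + (m P′ k)) ≡ sumℤ N (λ k → b k * + (m P′ k)) mod P) →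
    ∀ m → m < p → a m ≡ b m mod P
  falling-coefficients-unique {N} a b p≤N agree = <-rec _ step
    where
      split : ∀ {m} (c : ℕ → ℤ) → m < N →
              sumℤ N (λ k → c k * + (m P′ k)) ≡ sumℤ m (λ k → c k * + (m P′ k)) + c m * + (m !)
      split {m} c m<N =
        trans (sumℤ-truncate m<N (λ k m<k → trans (cong (λ x → c k * + x) (k>n⇒nP′k≡0 m<k))
                                                  (ℤₚ.*-zeroʳ (c k))))
              (cong (λ x → sumℤ m (λ k → c k * + (m P′ k)) + c m * + x) (nP′n≡n! m))

      step : ∀ m → (∀ {i} → i < m → i < p → a i ≡ b i mod P) → m < p → a m ≡ b m mod P
      step m ih m<p = *-cancelʳ-mod (p∤m! m<p) (+-cancelˡ-mod lower (begin
        sumℤ m (λ k → a k * + (m P′ k)) + a m * + (m !)  ≡⟨ split a m<N ⟨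
        sumℤ N (λ k → a k * + (m P′ k))                  ≈⟨ agree m m<p ⟩
        sumℤ N (λ k → b k * + (m P′ k))                  ≡⟨ split b m<N ⟩
        sumℤ m (λ k → b k * + (m P′ k)) + b m * + (m !)  ∎))
        where
          m<N = ℕₚ.<-≤-trans m<p p≤N
          lower : sumℤ m (λ k → a k * + (m P′ k)) ≡ sumℤ m (λ k → b k * + (m P′ k)) mod P
          lower = sumℤ-cong-mod m (λ k k<m → *-cong-mod (ih k<m (ℕₚ.<-trans k<m m<p)) mod-refl)

  stirling2[p,k]≡stirling2[1,k] : ∀ k → k < p → stirling2ℤ p k ≡ stirling2ℤ 1 k mod P
  stirling2[p,k]≡stirling2[1,k] =
    falling-coefficients-unique (stirling2ℤ p) (stirling2ℤ 1) (ℕₚ.n≤1+n p) values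
    where
      values : ∀ m → m < p → sumℤ (suc p) (λ k → stirling2ℤ p k * + (m P′ k))
                               ≡ sumℤ (suc p) (λ k → stirling2ℤ 1 k * + (m P′ k)) mod P
      values m _ = begin
        sumℤ (suc p) (λ k → stirling2ℤ p k * + (m P′ k))
          ≡⟨ falling-factorial-expansion m p ⟨
        (+ m) ^ p
          ≈⟨ fermat (+ m) ⟩
        + m
          ≡⟨ ℤₚ.^-identityʳ (+ m) ⟨
        (+ m) ^ 1
          ≡⟨ falling-factorial-expansion m 1 ⟩
        sumℤ 2 (λ k → stirling2ℤ 1 k * + (m P′ k))
          ≡⟨ sumℤ-truncate (ℕₚ.m≤n⇒m≤1+n 1<p) vanish ⟨
        sumℤ (suc p) (λ k → stirling2ℤ 1 k * + (m P′ k)) ∎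
        where vanish : ∀ k → 2 ≤ k → stirling2ℤ 1 k * + (m P′ k) ≡ 0ℤ
              vanish k 1<k = cong (λ s → + s * + (m P′ k)) (k>n⇒stirling2[n,k]≡0 1<k)

  bell[p]≡bell[1]+bell[0] : bellℤ p ≡ bellℤ 1 + bellℤ 0 mod P
  bell[p]≡bell[1]+bell[0] = begin
    bellℤ p
      ≡⟨ bellℤ≡Σstirling2 (ℕₚ.n<1+n p) ⟩
    sumℤ p (stirling2ℤ p) + stirling2ℤ p p
      ≈⟨ +-cong-mod (sumℤ-cong-mod p stirling2[p,k]≡stirling2[1,k]) mod-refl ⟩
    sumℤ p (stirling2ℤ 1) + stirling2ℤ p p
      ≡⟨ cong₂ _+_ (sumℤ-truncate 1<p vanish) (cong +_ (stirling2[n,n]≡1 p)) ⟩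
    bellℤ 1 + bellℤ 0 ∎
    where vanish : ∀ k → 2 ≤ k → stirling2ℤ 1 k ≡ 0ℤ
          vanish k 1<k = cong +_ (k>n⇒stirling2[n,k]≡0 1<k)

  conv-freshman-split : ∀ r b m →
                        conv r b (p ℕ.+ m) ≡ conv r (λ k → b (p ℕ.+ k) + r ^ p * b k) m mod P
  conv-freshman-split r b m = begin
    conv r b (p ℕ.+ m)
      ≡⟨ conv-split r p m b ⟩
    conv r (λ k → conv r (λ i → b (i ℕ.+ k)) p) m
      ≈⟨ conv-congʳ-mod r m (λ k _ → conv-freshman r (λ i → b (i ℕ.+ k))) ⟩
    conv r (λ k → b (p ℕ.+ k) + r ^ p * b k) m ∎

  Touchard : (ℕ → ℤ) → Set
  Touchard b = ∀ m → b (p ℕ.+ m) ≡ b (suc m) + b m mod P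

  -- Both sides solve x (k + 1) ≡ conv 1ℤ x k + B_{k+1} and agree at k = 0.
  touchard-bell : Touchard bellℤ
  touchard-bell = conv-recurrence-unique initial shifted plain
    where
      initial : bellℤ (p ℕ.+ 0) ≡ bellℤ 1 + bellℤ 0 mod P
      initial = mod-trans (mod-reflexive (cong bellℤ (ℕₚ.+-identityʳ p))) bell[p]≡bell[1]+bell[0]

      shifted : ∀ k → bellℤ (p ℕ.+ suc k) ≡ conv 1ℤ (λ i → bellℤ (p ℕ.+ i)) k + bellℤ (suc k) mod P
      shifted k = begin
        bellℤ (p ℕ.+ suc k)
          ≡⟨ cong bellℤ (ℕₚ.+-suc p k) ⟩
        bellℤ (suc (p ℕ.+ k))
          ≡⟨ bellℤ-suc (p ℕ.+ k) ⟩
        conv 1ℤ bellℤ (p ℕ.+ k)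
          ≈⟨ conv-freshman-split 1ℤ bellℤ k ⟩
        conv 1ℤ (λ i → bellℤ (p ℕ.+ i) + 1ℤ ^ p * bellℤ i) k
          ≡⟨ conv-congʳ 1ℤ k (λ i _ → cong (_+_ (bellℤ (p ℕ.+ i))) (one-pow (bellℤ i))) ⟩
        conv 1ℤ (λ i → bellℤ (p ℕ.+ i) + bellℤ i) k
          ≡⟨ conv-+ 1ℤ k (λ i → bellℤ (p ℕ.+ i)) bellℤ ⟩
        conv 1ℤ (λ i → bellℤ (p ℕ.+ i)) k + conv 1ℤ bellℤ k
          ≡⟨ cong (_+_ (conv 1ℤ (λ i → bellℤ (p ℕ.+ i)) k)) (bellℤ-suc k) ⟨
        conv 1ℤ (λ i → bellℤ (p ℕ.+ i)) k + bellℤ (suc k) ∎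
        where one-pow : ∀ x → 1ℤ ^ p * x ≡ x
              one-pow x = trans (cong (_* x) (ℤₚ.^-zeroˡ p)) (ℤₚ.*-identityˡ x)

      plain : ∀ k → bellℤ (suc (suc k)) + bellℤ (suc k)
                    ≡ conv 1ℤ (λ i → bellℤ (suc i) + bellℤ i) k + bellℤ (suc k) mod P
      plain k = mod-reflexive (cong (_+ bellℤ (suc k)) (bellℤ-suc-suc k))

  touchard-conv : ∀ r b → Touchard b → Touchard (conv r b)
  touchard-conv r b touchard-b m = begin
    conv r b (p ℕ.+ m)
      ≈⟨ conv-freshman-split r b m ⟩
    conv r (λ k → b (p ℕ.+ k) + r ^ p * b k) m
      ≈⟨ conv-congʳ-mod r m (λ k _ → +-cong-mod (touchard-b k) (*-cong-mod (fermat r) mod-refl)) ⟩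
    conv r (λ k → b (suc k) + b k + r * b k) m
      ≡⟨ conv-congʳ r m (λ k _ → regroup (b (suc k)) (b k) r) ⟩
    conv r (λ k → shift+ r b k + b k) m
      ≡⟨ conv-+ r m (shift+ r b) b ⟩
    conv r (shift+ r b) m + conv r b m
      ≡⟨ cong (_+ conv r b m) (conv-suc r m b) ⟨
    conv r b (suc m) + conv r b m ∎
    where regroup : ∀ x y r → x + y + r * y ≡ x + r * y + y
          regroup = solve-∀

  touchard-shift+ : ∀ c b → Touchard b → Touchard (shift+ c b)
  touchard-shift+ c b touchard-b m = begin
    b (suc (p ℕ.+ m)) + c * b (p ℕ.+ m)
      ≡⟨ cong (λ i → b i + c * b (p ℕ.+ m)) (ℕₚ.+-suc p m) ⟨
    b (p ℕ.+ suc m) + c * b (p ℕ.+ m)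
      ≈⟨ +-cong-mod (touchard-b (suc m)) (*-cong-mod (mod-refl {a = c}) (touchard-b m)) ⟩
    b (suc (suc m)) + b (suc m) + c * (b (suc m) + b m)
      ≡⟨ regroup (b (suc (suc m))) (b (suc m)) (b m) c ⟩
    shift+ c b (suc m) + shift+ c b m ∎
    where regroup : ∀ x y z c → x + y + c * (y + z) ≡ x + c * y + (y + c * z)
          regroup = solve-∀

  touchard-iterate : ∀ {M c} → (∀ b → Touchard b → ∀ m → b (m ℕ.+ M) ≡ shift+ c b m mod P) →
                     ∀ b → Touchard b →
                     ∀ j m → b (m ℕ.+ j ℕ.* M) ≡ conv c (λ i → b (m ℕ.+ i)) j mod P
  touchard-iterate _ _ _ zero m = mod-refl
  touchard-iterate {M} {c} E^M≡E+c b touchard-b (suc j) m = begin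
    b (m ℕ.+ (M ℕ.+ j ℕ.* M))
      ≡⟨ cong b (reorder m M (j ℕ.* M)) ⟩
    b (m ℕ.+ j ℕ.* M ℕ.+ M)
      ≈⟨ E^M≡E+c b touchard-b (m ℕ.+ j ℕ.* M) ⟩
    shift+ c b (m ℕ.+ j ℕ.* M)
      ≈⟨ touchard-iterate E^M≡E+c (shift+ c b) (touchard-shift+ c b touchard-b) j m ⟩
    conv c (λ i → shift+ c b (m ℕ.+ i)) j
      ≡⟨ conv-congʳ c j (λ i _ → cong (λ l → b l + c * b (m ℕ.+ i)) (ℕₚ.+-suc m i)) ⟨
    conv c (shift+ c (λ i → b (m ℕ.+ i))) j
      ≡⟨ conv-suc c j (λ i → b (m ℕ.+ i)) ⟨
    conv c (λ i → b (m ℕ.+ i)) (suc j) ∎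
    where reorder : ∀ a b c → a ℕ.+ (b ℕ.+ c) ≡ a ℕ.+ c ℕ.+ b
          reorder a b c = trans (cong (a ℕ.+_) (ℕₚ.+-comm b c)) (sym (ℕₚ.+-assoc a c b))

  touchard-pow : ∀ k b → Touchard b → ∀ m → b (m ℕ.+ p ℕ.^ k) ≡ shift+ (+ k) b m mod P
  touchard-pow zero    b _ m =
    mod-reflexive (trans (cong b (ℕₚ.+-comm m 1)) (sym (ℤₚ.+-identityʳ (b (suc m)))))
  touchard-pow (suc k) b touchard-b m = begin
    b (m ℕ.+ p ℕ.* p ℕ.^ k)
      ≈⟨ touchard-iterate {c = + k} (touchard-pow k) b touchard-b p m ⟩
    conv (+ k) (λ i → b (m ℕ.+ i)) p
      ≈⟨ conv-freshman (+ k) (λ i → b (m ℕ.+ i)) ⟩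
    b (m ℕ.+ p) + (+ k) ^ p * b (m ℕ.+ 0)
      ≈⟨ +-cong-mod touchard-b′ (*-cong-mod (fermat (+ k)) (mod-reflexive (cong b (ℕₚ.+-identityʳ m)))) ⟩
    b (suc m) + b m + + k * b m
      ≡⟨ regroup (b (suc m)) (b m) (+ k) ⟩
    b (suc m) + + suc k * b m ∎
    where
      touchard-b′ : b (m ℕ.+ p) ≡ b (suc m) + b m mod P
      touchard-b′ = mod-trans (mod-reflexive (cong b (ℕₚ.+-comm m p))) (touchard-b m)
      regroup : ∀ x y k → x + y + k * y ≡ x + (1ℤ + k) * y
      regroup = solve-∀

  conv-neg-geomK : ∀ j m → conv (- + j) bellℤ (m ℕ.+ geomK p j) ≡ bellℤ m mod P
  conv-neg-geomK zero    m =
    mod-reflexive (trans (conv-0ℤ (m ℕ.+ 0) bellℤ) (cong bellℤ (ℕₚ.+-identityʳ m)))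
  conv-neg-geomK (suc j) m = begin
    conv r bellℤ (m ℕ.+ (K ℕ.+ p ℕ.^ suc j))
      ≡⟨ cong (conv r bellℤ) (ℕₚ.+-assoc m K (p ℕ.^ suc j)) ⟨
    conv r bellℤ (m ℕ.+ K ℕ.+ p ℕ.^ suc j)
      ≈⟨ touchard-pow (suc j) (conv r bellℤ) (touchard-conv r bellℤ touchard-bell) (m ℕ.+ K) ⟩
    shift+ (- r) (conv r bellℤ) (m ℕ.+ K)
      ≡⟨ shift+-conv r (m ℕ.+ K) bellℤ ⟩
    conv r (λ i → bellℤ (suc i)) (m ℕ.+ K)
      ≡⟨ conv-bell-shift r (m ℕ.+ K) ⟩
    conv (r + 1ℤ) bellℤ (m ℕ.+ K)
      ≡⟨ cong (λ s → conv s bellℤ (m ℕ.+ K)) (lemma (+ j)) ⟩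
    conv (- + j) bellℤ (m ℕ.+ K)
      ≈⟨ conv-neg-geomK j m ⟩
    bellℤ m ∎
    where
      r = - + suc j
      K = geomK p j
      lemma : ∀ x → - (1ℤ + x) + 1ℤ ≡ - x
      lemma = solve-∀

  rBell-congruence : ∀ r m → geomK p ((- r) %ℕ p) ≤ m →
                     rBell m r ≡ bellℤ (m ∸ geomK p ((- r) %ℕ p)) mod P
  rBell-congruence r m K≤m = begin
    rBell m r                         ≡⟨ conv≡binomialSum r bellℤ m ⟨
    conv r bellℤ m                    ≈⟨ conv-congˡ-mod m bellℤ r≡-s ⟩
    conv (- + s) bellℤ m              ≡⟨ cong (conv (- + s) bellℤ) (ℕₚ.m∸n+n≡m K≤m) ⟨
    conv (- + s) bellℤ (m ∸ K ℕ.+ K)  ≈⟨ conv-neg-geomK s (m ∸ K) ⟩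
    bellℤ (m ∸ K)                     ∎
    where
      s = (- r) %ℕ p
      K = geomK p s
      r≡-s : r ≡ - + s mod P
      r≡-s = mod-trans (mod-reflexive (sym (ℤₚ.neg-involutive r))) (neg-cong-mod (%ℕ-mod (- r) p))

corollary5 : (p : ℕ) .{{_ : NonZero p}} → Prime p → (r : ℤ) →
               let s = (- r) %ℕ p in
               let K = geomK p s in
               (n : ℕ) → K ≤ n →
               (+ p) ∣ (rBell n r - + bell (n ∸ K))
corollary5 zero    p-prime = ⊥-elim (¬prime[0] p-prime)
corollary5 (suc n) p-prime r m K≤m =
  Signed.∣⇒∣ᵤ (_≡_mod_.difference (rBell-congruence p-prime r m K≤m))
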